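{- Let $m\ge 3$ and $n\ge 2$. For every positive integer $k$, $$\chi^b_{B_1^*(m,n)}(2k)=\Big[\sum_{i=0}^{m-3}(-1)^i(2k-1)^{(m-2)-i}\Big]\,\chi^b_{B_1^*(m,n-1)}(2k)+(-1)^{m-2}\chi^b_{B_m^{n-1}}(2k).$$
   Context: A signed graph $(G,\sigma)$ is a finite graph $G$ (parallel edges allowed) with a sign function $\sigma:E(G)\to\{+1,-1\}$; its signature is the set of negative edges. A zero-free signed coloring in $2k$ colors is a map $c:V(G)\to\{ -k,\dots,-1,1,\dots,k\}$; it is proper if $c(y)\neq\sigma(e)c(x)$ for every edge $e=xy$. The balanced chromatic polynomial $\chi^b_{(G,\sigma)}(2k)$ is the number of proper zero-free signed colorings in $2k$ colors. For integers $m\ge 3$, $n\ge 1$, the Book graph $B(m,n)$ has vertex set $\{u,v\}\cup\{u_j^l:1\le l\le n,\,1\le j\le m-2\}$ and consists of the $n$ cycles $u\,u_1^l\cdots u_{m-2}^l\,v\,u$ sharing the edge $uv$. $B_1^*(m,n)$ denotes $B(m,n)$ with signature $\{uv\}$. The signed graph $B_m^n$ is obtained from $B(m,n)$ with all edges positive by replacing the edge $uv$ with two parallel edges between $u$ and $v$, one positive and one negative. -}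

module Defs where

open import Data.Nat using (ℕ; zero; suc; _+_; _*_; _∸_; _≡ᵇ_)
open import Data.Integer as ℤ using (ℤ; +_; -_; _≟_) renaming (_*_ to _*ℤ_; _+_ to _+ℤ_)
open import Data.List using (List; []; _∷_; _++_; map; concatMap; length; upTo; foldr)
open import Data.Bool using (Bool; true; false; _∧_; not; if_then_else_)
open import Relation.Nullary.Decidable using (⌊_⌋)

data Sign : Set where
  pos neg : Sign

signℤ : Sign → ℤ
signℤ pos = + 1
signℤ neg = - (+ 1)

-- An edge x y with a sign; vertices are natural-number indices 0 .. N-1.
record Edge : Set where
  constructor edge
  field
    ex : ℕ
    ey : ℕ
    sg : Sign
open Edge public

-- A signed multigraph (parallel edges allowed): number of vertices and list of edges.
record SignedGraph : Set where
  constructor sgraph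
  field
    nV    : ℕ
    edges : List Edge
open SignedGraph public

colors : ℕ → List ℤ
colors k = map (λ j → + suc j) (upTo k) ++ map (λ j → - (+ suc j)) (upTo k)

-- All maps from N vertices to the color list, as lists of length N
-- (the i-th entry is the color of vertex i).
allColorings : List ℤ → ℕ → List (List ℤ)
allColorings cs zero    = [] ∷ []
allColorings cs (suc N) = concatMap (λ c → map (c ∷_) (allColorings cs N)) cs

-- Color of vertex i (default 0 never used: all edge endpoints are < nV).
colorOf : List ℤ → ℕ → ℤ
colorOf []       _       = + 0
colorOf (c ∷ cs) zero    = c
colorOf (c ∷ cs) (suc i) = colorOf cs i

properEdge : List ℤ → Edge → Bool
properEdge c (edge x y s) = not ⌊ colorOf c y ≟ (signℤ s *ℤ colorOf c x) ⌋

proper : List ℤ → List Edge → Bool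
proper c []       = true
proper c (e ∷ es) = properEdge c e ∧ proper c es

countTrue : List Bool → ℕ
countTrue []          = 0
countTrue (true ∷ bs) = suc (countTrue bs)
countTrue (false ∷ bs) = countTrue bs

-- Balanced chromatic polynomial evaluated at 2k: number of proper
-- zero-free signed colorings in 2k colors.
χb : SignedGraph → ℕ → ℕ
χb (sgraph N es) k = countTrue (map (λ c → proper c es) (allColorings (colors k) N))

-- Book graph B(m,n): vertex u = 0, v = 1, u_{j+1}^{l+1} = 2 + l*(m-2) + j
-- (0 ≤ l < n, 0 ≤ j < m-2). All edges positive except the edges between u and v.
bookVertex : ℕ → ℕ → ℕ → ℕ
bookVertex m l j = 2 + l * (m ∸ 2) + j

innerEdges : ℕ → ℕ → List Edge
innerEdges m l = map (λ j → edge (bookVertex m l j) (bookVertex m l (suc j)) pos) (upTo (m ∸ 3))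

pageEdges : ℕ → ℕ → List Edge
pageEdges m l =
  edge 0 (bookVertex m l 0) pos ∷
  (innerEdges m l ++ (edge (bookVertex m l (m ∸ 3)) 1 pos ∷ []))

pagesEdges : ℕ → ℕ → List Edge
pagesEdges m n = concatMap (pageEdges m) (upTo n)

bookNV : ℕ → ℕ → ℕ
bookNV m n = 2 + n * (m ∸ 2)

B1* : ℕ → ℕ → SignedGraph
B1* m n = sgraph (bookNV m n) (edge 0 1 neg ∷ pagesEdges m n)

Bmn : ℕ → ℕ → SignedGraph
Bmn m n = sgraph (bookNV m n) (edge 0 1 pos ∷ edge 0 1 neg ∷ pagesEdges m n)

sgnPow : ℕ → ℤ
sgnPow zero    = + 1
sgnPow (suc i) = - sgnPow i

powℤ : ℤ → ℕ → ℤ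
powℤ a zero    = + 1
powℤ a (suc e) = a *ℤ powℤ a e

sumℤ : List ℤ → ℤ
sumℤ = foldr _+ℤ_ (+ 0)

bookCoeff : ℕ → ℕ → ℤ
bookCoeff m k = sumℤ (map (λ i → sgnPow i *ℤ powℤ (+ (2 * k ∸ 1)) ((m ∸ 2) ∸ i)) (upTo (m ∸ 2)))

module Submission where

-- Write m = t + 3 (so every page has t + 1 inner vertices), k = k' + 1 and d = 2k - 2, so that
-- there are q = 2k = d + 2 colors.  Fix the colors cu, cv of the spine vertices u, v.  The pages
-- then become independent: each one is a path u – x₁ – … – x_{t+1} – v whose consecutive colors
-- must differ (all page edges are positive), so the number of admissible page colorings is Wⁿ,
-- where W depends only on whether cu = cv.  A first-step recurrence gives W = sameEnds d (t+1)
-- if cu = cv and W = diffEnds d (t+1) otherwise (abbreviated S and D).  Summing over (cu, cv)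
-- subject to the spine edges gives the closed forms
--     χb(B₁*(m,n)) = q (Sⁿ + d Dⁿ)       (only cv = -cu is forbidden),
--     χb(B_mⁿ)     = q d Dⁿ              (cv = cu and cv = -cu are forbidden).
-- On the integer side, the alternating sum in the theorem equals S and (-1)^(m-2) equals D - S,
-- so the recurrence is the ring identity q(S·Sⁿ + d·D·Dⁿ) = S·q(Sⁿ + d Dⁿ) + (D - S)·q d Dⁿ.

module BookChromatic where
  open import Defs
  open import Data.Nat
  open import Data.Nat.Properties
  open import Data.Integer as Z using (ℤ; -[1+_]) renaming (+_ to ι)
  import Data.Integer.Properties as ZP
  open import Data.List using (List; []; _∷_; _++_; map; concatMap; length; upTo; applyUpTo)
  open import Data.List.Properties using (map-upTo; length-++; length-map; length-upTo; map-∘)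
  open import Data.List.Membership.Propositional using (_∈_)
  open import Data.List.Membership.Propositional.Properties using (∈-map⁺; ∈-map⁻; ∈-++⁺ˡ; ∈-++⁺ʳ; ∈-++⁻)
  open import Data.List.Relation.Unary.Any using (here; there)
  open import Data.List.Relation.Unary.All as All using ()
  open import Data.List.Relation.Unary.AllPairs using (_∷_)
  open import Data.List.Relation.Unary.Unique.Propositional using (Unique)
  import Data.List.Relation.Unary.Unique.Propositional.Properties as Unique
  open import Data.Bool using (Bool; true; false; _∧_; not; if_then_else_)
  open import Data.Bool.Properties using (∧-assoc; ∧-identityʳ)
  open import Relation.Nullary using (Dec; yes; no; ¬_)
  open import Relation.Nullary.Decidable using (⌊_⌋)
  open import Relation.Binary.PropositionalEquality
  open import Data.Empty using (⊥-elim)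
  open import Data.Sum using (inj₁; inj₂)
  open import Data.Product using (_,_; _×_)
  open import Algebra.Properties.CommutativeSemigroup +-commutativeSemigroup using () renaming (x∙yz≈y∙xz to +-swap)
  import Data.Nat.Tactic.RingSolver as ℕ-Ring
  import Data.Integer.Tactic.RingSolver as ℤ-Ring
  open ≡-Reasoning

  ind : Bool → ℕ
  ind true  = 1
  ind false = 0

  ind-∧ : ∀ a b → ind (a ∧ b) ≡ ind a * ind b
  ind-∧ true  b = sym (+-identityʳ (ind b))
  ind-∧ false b = refl

  sumOver : {A : Set} → List A → (A → ℕ) → ℕ
  sumOver []       f = 0
  sumOver (x ∷ xs) f = f x + sumOver xs f

  countTrue-map : {A : Set} (L : List A) (f : A → Bool) → countTrue (map f L) ≡ sumOver L (λ x → ind (f x))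
  countTrue-map []      f = refl
  countTrue-map (x ∷ L) f with f x
  ... | true  = cong suc (countTrue-map L f)
  ... | false = countTrue-map L f

  sumOver-++ : {A : Set} (xs ys : List A) (f : A → ℕ) → sumOver (xs ++ ys) f ≡ sumOver xs f + sumOver ys f
  sumOver-++ []       ys f = refl
  sumOver-++ (x ∷ xs) ys f = trans (cong (f x +_) (sumOver-++ xs ys f)) (sym (+-assoc (f x) _ _))

  sumOver-map : {A B : Set} (g : A → B) (L : List A) (f : B → ℕ) → sumOver (map g L) f ≡ sumOver L (λ x → f (g x))
  sumOver-map g []      f = refl
  sumOver-map g (x ∷ L) f = cong (f (g x) +_) (sumOver-map g L f)

  sumOver-concatMap : {A B : Set} (g : A → List B) (L : List A) (f : B → ℕ) →
    sumOver (concatMap g L) f ≡ sumOver L (λ x → sumOver (g x) f)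
  sumOver-concatMap g []      f = refl
  sumOver-concatMap g (x ∷ L) f =
    trans (sumOver-++ (g x) (concatMap g L) f) (cong (sumOver (g x) f +_) (sumOver-concatMap g L f))

  sumOver-cong∈ : {A : Set} (L : List A) {f g : A → ℕ} → (∀ x → x ∈ L → f x ≡ g x) → sumOver L f ≡ sumOver L g
  sumOver-cong∈ []      h = refl
  sumOver-cong∈ (x ∷ L) h = cong₂ _+_ (h x (here refl)) (sumOver-cong∈ L (λ y p → h y (there p)))

  sumOver-cong : {A : Set} (L : List A) {f g : A → ℕ} → (∀ x → f x ≡ g x) → sumOver L f ≡ sumOver L g
  sumOver-cong L h = sumOver-cong∈ L (λ x _ → h x)

  sumOver-*ˡ : {A : Set} (L : List A) (c : ℕ) (f : A → ℕ) → sumOver L (λ x → c * f x) ≡ c * sumOver L f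
  sumOver-*ˡ []      c f = sym (*-zeroʳ c)
  sumOver-*ˡ (x ∷ L) c f = trans (cong (c * f x +_) (sumOver-*ˡ L c f)) (sym (*-distribˡ-+ c (f x) _))

  sumOver-*ʳ : {A : Set} (L : List A) (c : ℕ) (f : A → ℕ) → sumOver L (λ x → f x * c) ≡ sumOver L f * c
  sumOver-*ʳ []      c f = refl
  sumOver-*ʳ (x ∷ L) c f = trans (cong (f x * c +_) (sumOver-*ʳ L c f)) (sym (*-distribʳ-+ c (f x) _))

  sumOver-const : {A : Set} (L : List A) (c : ℕ) → sumOver L (λ _ → c) ≡ length L * c
  sumOver-const []      c = refl
  sumOver-const (x ∷ L) c = cong (c +_) (sumOver-const L c)

  module _ (cs : List ℤ) where
    sum-colorings-suc : ∀ N f → sumOver (allColorings cs (suc N)) f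
                                ≡ sumOver cs (λ x → sumOver (allColorings cs N) (λ r → f (x ∷ r)))
    sum-colorings-suc N f =
      trans (sumOver-concatMap _ cs f) (sumOver-cong cs (λ x → sumOver-map (x ∷_) (allColorings cs N) f))

    sum-colorings-cong : ∀ N {f g : List ℤ → ℕ} → (∀ a → length a ≡ N → f a ≡ g a) →
      sumOver (allColorings cs N) f ≡ sumOver (allColorings cs N) g
    sum-colorings-cong zero    h = cong (_+ 0) (h [] refl)
    sum-colorings-cong (suc N) {f} {g} h = begin
      sumOver (allColorings cs (suc N)) f                             ≡⟨ sum-colorings-suc N f ⟩
      sumOver cs (λ x → sumOver (allColorings cs N) (λ r → f (x ∷ r))) ≡⟨ sumOver-cong cs (λ x →
                                                                           sum-colorings-cong N (λ a e → h (x ∷ a) (cong suc e))) ⟩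
      sumOver cs (λ x → sumOver (allColorings cs N) (λ r → g (x ∷ r))) ≡⟨ sum-colorings-suc N g ⟨
      sumOver (allColorings cs (suc N)) g                             ∎

    sum-colorings-++ : ∀ A B f → sumOver (allColorings cs (A + B)) f
                                 ≡ sumOver (allColorings cs A) (λ a → sumOver (allColorings cs B) (λ b → f (a ++ b)))
    sum-colorings-++ zero    B f = sym (+-identityʳ _)
    sum-colorings-++ (suc A) B f = begin
      sumOver (allColorings cs (suc A + B)) f                                    ≡⟨ sum-colorings-suc (A + B) f ⟩
      sumOver cs (λ x → sumOver (allColorings cs (A + B)) (λ r → f (x ∷ r)))     ≡⟨ sumOver-cong cs (λ x →
                                                                                      sum-colorings-++ A B (λ r → f (x ∷ r))) ⟩
      sumOver cs (λ x → sumOver (allColorings cs A)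
                          (λ a → sumOver (allColorings cs B) (λ b → f (x ∷ a ++ b)))) ≡⟨ sum-colorings-suc A _ ⟨
      sumOver (allColorings cs (suc A)) (λ a → sumOver (allColorings cs B) (λ b → f (a ++ b))) ∎

  eqb : ℤ → ℤ → Bool
  eqb x y = ⌊ x Z.≟ y ⌋

  neq : ℤ → ℤ → Bool
  neq x y = not (eqb x y)

  eqb-refl : ∀ x → eqb x x ≡ true
  eqb-refl x with x Z.≟ x
  ... | yes _  = refl
  ... | no x≢x = ⊥-elim (x≢x refl)

  eqb-≢ : ∀ {x y} → x ≢ y → eqb x y ≡ false
  eqb-≢ {x} {y} x≢y with x Z.≟ y
  ... | yes x≡y = ⊥-elim (x≢y x≡y)
  ... | no _    = refl

  eqb-sym : ∀ x y → eqb x y ≡ eqb y x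
  eqb-sym x y with x Z.≟ y
  ... | yes refl = sym (eqb-refl x)
  ... | no x≢y   = sym (eqb-≢ (λ y≡x → x≢y (sym y≡x)))

  sum-split-at : ∀ {cs : List ℤ} {a} (f : ℤ → ℕ) → Unique cs → a ∈ cs →
    sumOver cs f ≡ f a + sumOver cs (λ x → ind (neq x a) * f x)
  sum-split-at {y ∷ ys} f (y∉ys ∷ _) (here refl) =
    cong (f y +_) (sym (cong₂ _+_ (cong (λ b → ind (not b) * f y) (eqb-refl y))
                                  (sumOver-cong∈ ys (λ x x∈ys → keep x (All.lookup y∉ys x∈ys)))))
    where
    keep : ∀ x → y ≢ x → ind (neq x y) * f x ≡ f x
    keep x y≢x = trans (cong (λ b → ind (not b) * f x) (eqb-≢ (λ x≡y → y≢x (sym x≡y)))) (+-identityʳ (f x))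
  sum-split-at {y ∷ ys} {a} f (y∉ys ∷ u) (there a∈ys) = begin
    f y + sumOver ys f               ≡⟨ cong (f y +_) (sum-split-at f u a∈ys) ⟩
    f y + (f a + sumOver ys g)       ≡⟨ +-swap (f y) (f a) (sumOver ys g) ⟩
    f a + (f y + sumOver ys g)       ≡⟨ cong (λ z → f a + (z + sumOver ys g)) keep-y ⟨
    f a + (g y + sumOver ys g)       ∎
    where
    g : ℤ → ℕ
    g x = ind (neq x a) * f x
    keep-y : g y ≡ f y
    keep-y = trans (cong (λ b → ind (not b) * f y) (eqb-≢ (All.lookup y∉ys a∈ys))) (+-identityʳ (f y))

  module _ {cs : List ℤ} (e : ℕ) (len : length cs ≡ suc e) (u : Unique cs) where
    sum-others-const : ∀ {a} → a ∈ cs → (C : ℕ) → sumOver cs (λ x → ind (neq x a) * C) ≡ e * C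
    sum-others-const {a} a∈ C = +-cancelˡ-≡ C _ (e * C) (begin
      C + sumOver cs (λ x → ind (neq x a) * C) ≡⟨ sum-split-at (λ _ → C) u a∈ ⟨
      sumOver cs (λ _ → C)                      ≡⟨ sumOver-const cs C ⟩
      length cs * C                             ≡⟨ cong (_* C) len ⟩
      C + e * C                                 ∎)

    sum-excluding-self : ∀ {a} → a ∈ cs → (P D : ℕ) →
      sumOver cs (λ x → ind (neq x a) * (if eqb x a then P else D)) ≡ e * D
    sum-excluding-self {a} a∈ P D =
      trans (sumOver-cong cs (λ x → forget (eqb x a))) (sum-others-const a∈ D)
      where
      forget : ∀ b → ind (not b) * (if b then P else D) ≡ ind (not b) * D
      forget true  = refl
      forget false = refl

  sum-excluding-other : ∀ {cs : List ℤ} {a b} (d : ℕ) → length cs ≡ suc (suc d) → Unique cs →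
    a ∈ cs → b ∈ cs → a ≢ b → (P D : ℕ) →
    sumOver cs (λ x → ind (neq x a) * (if eqb x b then P else D)) ≡ P + d * D
  sum-excluding-other {cs} {a} {b} d len u a∈ b∈ a≢b P D = +-cancelˡ-≡ D _ (P + d * D) (begin
    D + sumOver cs (λ x → ind (neq x a) * h x)   ≡⟨ cong (_+ sumOver cs (λ x → ind (neq x a) * h x))
                                                         (cong (λ c → if c then P else D) (eqb-≢ a≢b)) ⟨
    h a + sumOver cs (λ x → ind (neq x a) * h x) ≡⟨ sum-split-at h u a∈ ⟨
    sumOver cs h                                 ≡⟨ sum-split-at h u b∈ ⟩
    h b + sumOver cs (λ x → ind (neq x b) * h x) ≡⟨ cong₂ _+_ (cong (λ c → if c then P else D) (eqb-refl b))
                                                          (sum-excluding-self (suc d) len u b∈ P D) ⟩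
    P + suc d * D                                ≡⟨ +-swap P D (d * D) ⟩
    D + (P + d * D)                              ∎)
    where
    h : ℤ → ℕ
    h x = if eqb x b then P else D

  colors-length : ∀ k → length (colors k) ≡ k + k
  colors-length k = trans (length-++ (map (λ j → ι (suc j)) (upTo k)))
    (cong₂ _+_ (trans (length-map _ (upTo k)) (length-upTo k)) (trans (length-map _ (upTo k)) (length-upTo k)))

  colors-unique : ∀ k → Unique (colors k)
  colors-unique k = Unique.++⁺ (Unique.map⁺ {f = λ j → ι (suc j)} ι-suc-injective (Unique.upTo⁺ k))
                               (Unique.map⁺ {f = λ j → -[1+ j ]} -[1ι-suc-injective (Unique.upTo⁺ k)) disjoint
    where
    ι-suc-injective : ∀ {x y} → ι (suc x) ≡ ι (suc y) → x ≡ y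
    ι-suc-injective refl = refl
    -[1ι-suc-injective : ∀ {x y} → -[1+ x ] ≡ -[1+ y ] → x ≡ y
    -[1ι-suc-injective refl = refl
    disjoint : ∀ {v} → ¬ (v ∈ map (λ j → ι (suc j)) (upTo k) × v ∈ map (λ j → -[1+ j ]) (upTo k))
    disjoint (p , q) with ∈-map⁻ (λ j → ι (suc j)) p | ∈-map⁻ (λ j → -[1+ j ]) q
    ... | _ , _ , refl | _ , _ , ()

  colors-neg : ∀ k {x} → x ∈ colors k → Z.- x ∈ colors k
  colors-neg k p with ∈-++⁻ (map (λ j → ι (suc j)) (upTo k)) p
  ... | inj₁ p' with ∈-map⁻ (λ j → ι (suc j)) p'
  ...   | _ , j∈ , refl = ∈-++⁺ʳ (map (λ j → ι (suc j)) (upTo k)) (∈-map⁺ (λ j → -[1+ j ]) j∈)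
  colors-neg k p | inj₂ p' with ∈-map⁻ (λ j → -[1+ j ]) p'
  ...   | _ , j∈ , refl = ∈-++⁺ˡ (∈-map⁺ (λ j → ι (suc j)) j∈)

  colors-≢-neg : ∀ k {x} → x ∈ colors k → Z.- x ≢ x
  colors-≢-neg k p with ∈-++⁻ (map (λ j → ι (suc j)) (upTo k)) p
  ... | inj₁ p' with ∈-map⁻ (λ j → ι (suc j)) p'
  ...   | _ , _ , refl = λ ()
  colors-≢-neg k p | inj₂ p' with ∈-map⁻ (λ j → -[1+ j ]) p'
  ...   | _ , _ , refl = λ ()

  pathOK : ℤ → List ℤ → ℤ → Bool
  pathOK a []       b = neq b a
  pathOK a (x ∷ xs) b = neq x a ∧ pathOK x xs b

  -- With d + 2 colors, the number of proper colorings of the N inner vertices of a path whose end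
  -- colors are equal (sameEnds) or different (diffEnds), by choosing the first inner color.
  mutual
    sameEnds : ℕ → ℕ → ℕ
    sameEnds d zero    = 0
    sameEnds d (suc N) = suc d * diffEnds d N

    diffEnds : ℕ → ℕ → ℕ
    diffEnds d zero    = 1
    diffEnds d (suc N) = sameEnds d N + d * diffEnds d N

  pathCount : ℕ → ℕ → Bool → ℕ
  pathCount d N same = if same then sameEnds d N else diffEnds d N

  module Paths (cs : List ℤ) (d : ℕ) (len : length cs ≡ suc (suc d)) (u : Unique cs) where
    paths : ℕ → ℤ → ℤ → ℕ
    paths N a b = sumOver (allColorings cs N) (λ p → ind (pathOK a p b))

    paths-suc : ∀ N a b → paths (suc N) a b ≡ sumOver cs (λ x → ind (neq x a) * paths N x b)
    paths-suc N a b = trans (sum-colorings-suc cs N _) (sumOver-cong cs (λ x →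
      trans (sumOver-cong (allColorings cs N) (λ r → ind-∧ (neq x a) (pathOK x r b)))
            (sumOver-*ˡ (allColorings cs N) (ind (neq x a)) _)))

    paths-closed : ∀ N a b → a ∈ cs → b ∈ cs → paths N a b ≡ pathCount d N (eqb b a)
    paths-closed zero    a b _  _  = base (eqb b a)
      where
      base : ∀ same → ind (not same) + 0 ≡ pathCount d 0 same
      base true  = refl
      base false = refl
    paths-closed (suc N) a b a∈ b∈ = begin
      paths (suc N) a b                                                       ≡⟨ paths-suc N a b ⟩
      sumOver cs (λ x → ind (neq x a) * paths N x b)                          ≡⟨ sumOver-cong∈ cs (λ x x∈ →
                                                                                   cong (ind (neq x a) *_) (by-induction x x∈)) ⟩
      sumOver cs (λ x → ind (neq x a) * pathCount d N (eqb x b))              ≡⟨ first-step (a Z.≟ b) ⟩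
      pathCount d (suc N) (eqb b a)                                           ∎
      where
      by-induction : ∀ x → x ∈ cs → paths N x b ≡ pathCount d N (eqb x b)
      by-induction x x∈ = trans (paths-closed N x b x∈ b∈) (cong (pathCount d N) (eqb-sym b x))
      first-step : Dec (a ≡ b) → sumOver cs (λ x → ind (neq x a) * pathCount d N (eqb x b)) ≡ pathCount d (suc N) (eqb b a)
      first-step (yes refl) = trans (sum-excluding-self (suc d) len u a∈ (sameEnds d N) (diffEnds d N))
                                    (cong (pathCount d (suc N)) (sym (eqb-refl a)))
      first-step (no a≢b)   = trans (sum-excluding-other d len u a∈ b∈ a≢b (sameEnds d N) (diffEnds d N))
                                    (cong (pathCount d (suc N)) (sym (eqb-≢ (λ b≡a → a≢b (sym b≡a)))))

  posE : ∀ c x y → properEdge c (edge x y pos) ≡ neq (colorOf c y) (colorOf c x)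
  posE c x y = cong (λ z → not ⌊ colorOf c y Z.≟ z ⌋) (ZP.*-identityˡ (colorOf c x))

  negE : ∀ c x y → properEdge c (edge x y neg) ≡ neq (colorOf c y) (Z.- colorOf c x)
  negE c x y = cong (λ z → not ⌊ colorOf c y Z.≟ z ⌋) (ZP.-1*i≡-i (colorOf c x))

  proper-++ : ∀ c xs ys → proper c (xs ++ ys) ≡ proper c xs ∧ proper c ys
  proper-++ c []       ys = refl
  proper-++ c (e ∷ xs) ys = trans (cong (properEdge c e ∧_) (proper-++ c xs ys)) (sym (∧-assoc (properEdge c e) _ _))

  properEdge-cong : ∀ c c' x y x' y' s → colorOf c x ≡ colorOf c' x' → colorOf c y ≡ colorOf c' y' →
    properEdge c (edge x y s) ≡ properEdge c' (edge x' y' s)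
  properEdge-cong c c' x y x' y' s p q = cong₂ (λ cx cy → not ⌊ cy Z.≟ (signℤ s Z.* cx) ⌋) p q

  proper-map-cong : ∀ {A : Set} c c' (g g' : A → Edge) L → (∀ j → properEdge c (g j) ≡ properEdge c' (g' j)) →
    proper c (map g L) ≡ proper c' (map g' L)
  proper-map-cong c c' g g' []      h = refl
  proper-map-cong c c' g g' (j ∷ L) h = cong₂ _∧_ (h j) (proper-map-cong c c' g g' L h)

  proper-concatMap-cong : ∀ {A B : Set} c c' (g : B → List Edge) (g' : A → List Edge) (f : A → B) L →
    (∀ l → proper c (g (f l)) ≡ proper c' (g' l)) → proper c (concatMap g (map f L)) ≡ proper c' (concatMap g' L)
  proper-concatMap-cong c c' g g' f []      h = refl
  proper-concatMap-cong c c' g g' f (l ∷ L) h = trans (proper-++ c (g (f l)) _)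
    (trans (cong₂ _∧_ (h l) (proper-concatMap-cong c c' g g' f L h)) (sym (proper-++ c' (g' l) _)))

  chainE : (ℕ → ℕ) → ℕ → List Edge
  chainE F t = map (λ j → edge (F j) (F (suc j)) pos) (upTo t) ++ (edge (F t) 1 pos ∷ [])

  pageE : (ℕ → ℕ) → ℕ → List Edge
  pageE F t = edge 0 (F 0) pos ∷ chainE F t

  pageE-cong : ∀ c c' F G t → colorOf c 0 ≡ colorOf c' 0 → colorOf c 1 ≡ colorOf c' 1 →
    (∀ j → colorOf c (F j) ≡ colorOf c' (G j)) → proper c (pageE F t) ≡ proper c' (pageE G t)
  pageE-cong c c' F G t h0 h1 hF = cong₂ _∧_ (properEdge-cong c c' 0 (F 0) 0 (G 0) pos h0 (hF 0)) (begin
    proper c (chainE F t)                                    ≡⟨ proper-++ c (inner F) last-F ⟩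
    proper c (inner F) ∧ proper c last-F                     ≡⟨ cong₂ _∧_ inner-cong (cong (_∧ true)
                                                                  (properEdge-cong c c' _ _ _ _ pos (hF t) h1)) ⟩
    proper c' (inner G) ∧ proper c' (edge (G t) 1 pos ∷ [])  ≡⟨ proper-++ c' (inner G) (edge (G t) 1 pos ∷ []) ⟨
    proper c' (chainE G t)                                   ∎)
    where
    inner : (ℕ → ℕ) → List Edge
    inner H = map (λ j → edge (H j) (H (suc j)) pos) (upTo t)
    last-F : List Edge
    last-F = edge (F t) 1 pos ∷ []
    inner-cong : proper c (inner F) ≡ proper c' (inner G)
    inner-cong = proper-map-cong c c' _ _ (upTo t) (λ j → properEdge-cong c c' _ _ _ _ pos (hF j) (hF (suc j)))

  chainE-suc : ∀ F t → chainE F (suc t) ≡ edge (F 0) (F 1) pos ∷ chainE (λ j → F (suc j)) t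
  chainE-suc F t = cong (λ L → edge (F 0) (F 1) pos ∷ (L ++ (edge (F (suc t)) 1 pos ∷ [])))
    (trans (cong (map (λ j → edge (F j) (F (suc j)) pos)) (sym (map-upTo suc t))) (sym (map-∘ (upTo t))))

  chain-proper : ∀ t F c x xs → length xs ≡ t → (∀ j → j ≤ t → colorOf c (F j) ≡ colorOf (x ∷ xs) j) →
    proper c (chainE F t) ≡ pathOK x xs (colorOf c 1)
  chain-proper zero F c x [] refl h = trans (cong (_∧ true) (posE c (F 0) 1))
    (trans (∧-identityʳ _) (cong (neq (colorOf c 1)) (h 0 z≤n)))
  chain-proper (suc t) F c x (x₁ ∷ xs) len h = trans (cong (proper c) (chainE-suc F t))
    (cong₂ _∧_ (trans (posE c (F 0) (F 1)) (cong₂ neq (h 1 (s≤s z≤n)) (h 0 z≤n)))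
               (chain-proper t (λ j → F (suc j)) c x₁ xs (suc-injective len) (λ j p → h (suc j) (s≤s p))))

  colorOf-++ˡ : ∀ a b j → j < length a → colorOf (a ++ b) j ≡ colorOf a j
  colorOf-++ˡ (x ∷ a) b zero    _       = refl
  colorOf-++ˡ (x ∷ a) b (suc j) (s≤s p) = colorOf-++ˡ a b j p

  colorOf-++ʳ : ∀ a b i → colorOf (a ++ b) (length a + i) ≡ colorOf b i
  colorOf-++ʳ []      b i = refl
  colorOf-++ʳ (x ∷ a) b i = colorOf-++ʳ a b i

  firstPage-proper : ∀ t cu cv x xs b → length xs ≡ t →
    proper (cu ∷ cv ∷ ((x ∷ xs) ++ b)) (pageEdges (3 + t) 0) ≡ pathOK cu (x ∷ xs) cv
  firstPage-proper t cu cv x xs b len = cong₂ _∧_ (posE (cu ∷ cv ∷ ((x ∷ xs) ++ b)) 0 2)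
    (chain-proper t (bookVertex (3 + t) 0) (cu ∷ cv ∷ ((x ∷ xs) ++ b)) x xs len
      (λ j j≤t → colorOf-++ˡ (x ∷ xs) b j (s≤s (subst (j ≤_) (sym len) j≤t))))

  page-shift : ∀ t l cu cv a b → length a ≡ suc t →
    proper (cu ∷ cv ∷ (a ++ b)) (pageEdges (3 + t) (suc l)) ≡ proper (cu ∷ cv ∷ b) (pageEdges (3 + t) l)
  page-shift t l cu cv a b len = pageE-cong (cu ∷ cv ∷ (a ++ b)) (cu ∷ cv ∷ b) _ _ t refl refl (λ j →
    trans (cong (colorOf (a ++ b)) (trans (+-assoc (suc t) (l * suc t) j) (cong (_+ (l * suc t + j)) (sym len))))
          (colorOf-++ʳ a b (l * suc t + j)))

  pages-split : ∀ t n cu cv a b → length a ≡ suc t →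
    proper (cu ∷ cv ∷ (a ++ b)) (pagesEdges (3 + t) (suc n))
      ≡ pathOK cu a cv ∧ proper (cu ∷ cv ∷ b) (pagesEdges (3 + t) n)
  pages-split t n cu cv (x ∷ xs) b len =
    trans (proper-++ (cu ∷ cv ∷ ((x ∷ xs) ++ b)) (pageEdges (3 + t) 0) _)
      (cong₂ _∧_ (firstPage-proper t cu cv x xs b (suc-injective len))
        (trans (cong (λ L → proper (cu ∷ cv ∷ ((x ∷ xs) ++ b)) (concatMap (pageEdges (3 + t)) L)) (sym (map-upTo suc n)))
               (proper-concatMap-cong _ _ (pageEdges (3 + t)) (pageEdges (3 + t)) suc (upTo n)
                  (λ l → page-shift t l cu cv (x ∷ xs) b len))))

  -- With the spine colors fixed, the n pages are colored independently.
  module Pages (cs : List ℤ) (t : ℕ) where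
    pageColorings : ℕ → ℤ → ℤ → ℕ
    pageColorings n cu cv = sumOver (allColorings cs (n * suc t)) (λ r → ind (proper (cu ∷ cv ∷ r) (pagesEdges (3 + t) n)))

    onePage : ℤ → ℤ → ℕ
    onePage cu cv = sumOver (allColorings cs (suc t)) (λ p → ind (pathOK cu p cv))

    pageColorings-pow : ∀ n cu cv → pageColorings n cu cv ≡ onePage cu cv ^ n
    pageColorings-pow zero    cu cv = refl
    pageColorings-pow (suc n) cu cv = begin
      pageColorings (suc n) cu cv                                                  ≡⟨ sum-colorings-++ cs (suc t) (n * suc t) _ ⟩
      sumOver (allColorings cs (suc t)) (λ a → sumOver (allColorings cs (n * suc t)) (λ b → ind (proper (cu ∷ cv ∷ (a ++ b)) pages)))
                                                                                   ≡⟨ sum-colorings-cong cs (suc t) split ⟩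
      sumOver (allColorings cs (suc t)) (λ a → ind (pathOK cu a cv) * pageColorings n cu cv)
                                                                                   ≡⟨ sumOver-*ʳ (allColorings cs (suc t)) _ _ ⟩
      onePage cu cv * pageColorings n cu cv                                        ≡⟨ cong (onePage cu cv *_) (pageColorings-pow n cu cv) ⟩
      onePage cu cv ^ suc n                                                        ∎
      where
      pages : List Edge
      pages = pagesEdges (3 + t) (suc n)
      split : ∀ a → length a ≡ suc t →
        sumOver (allColorings cs (n * suc t)) (λ b → ind (proper (cu ∷ cv ∷ (a ++ b)) pages)) ≡ ind (pathOK cu a cv) * pageColorings n cu cv
      split a len = trans (sumOver-cong (allColorings cs (n * suc t)) (λ b →
                              trans (cong ind (pages-split t n cu cv a b len)) (ind-∧ (pathOK cu a cv) _)))
                          (sumOver-*ˡ (allColorings cs (n * suc t)) (ind (pathOK cu a cv)) _)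

  χb-book : ∀ t n k (es : List Edge) (uvOK : ℤ → ℤ → Bool) → (∀ cu cv r → proper (cu ∷ cv ∷ r) es ≡ uvOK cu cv) →
    χb (sgraph (bookNV (3 + t) n) (es ++ pagesEdges (3 + t) n)) k
      ≡ sumOver (colors k) (λ cu → sumOver (colors k) (λ cv → ind (uvOK cu cv) * Pages.pageColorings (colors k) t n cu cv))
  χb-book t n k es uvOK spine =
    trans (countTrue-map (allColorings cs (2 + n * suc t)) (λ c → proper c (es ++ pagesEdges (3 + t) n)))
   (trans (sum-colorings-suc cs (suc (n * suc t)) _)
          (sumOver-cong cs (λ cu → trans (sum-colorings-suc cs (n * suc t) _)
                                         (sumOver-cong cs (λ cv → factor cu cv)))))
    where
    cs : List ℤ
    cs = colors k
    factor : ∀ cu cv → sumOver (allColorings cs (n * suc t)) (λ r → ind (proper (cu ∷ cv ∷ r) (es ++ pagesEdges (3 + t) n)))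
                       ≡ ind (uvOK cu cv) * Pages.pageColorings cs t n cu cv
    factor cu cv = trans (sumOver-cong (allColorings cs (n * suc t)) (λ r → begin
        ind (proper (cu ∷ cv ∷ r) (es ++ pagesEdges (3 + t) n))                          ≡⟨ cong ind (proper-++ (cu ∷ cv ∷ r) es _) ⟩
        ind (proper (cu ∷ cv ∷ r) es ∧ proper (cu ∷ cv ∷ r) (pagesEdges (3 + t) n))      ≡⟨ cong (λ s → ind (s ∧ _)) (spine cu cv r) ⟩
        ind (uvOK cu cv ∧ proper (cu ∷ cv ∷ r) (pagesEdges (3 + t) n))                   ≡⟨ ind-∧ (uvOK cu cv) _ ⟩
        ind (uvOK cu cv) * ind (proper (cu ∷ cv ∷ r) (pagesEdges (3 + t) n))             ∎))
      (sumOver-*ˡ (allColorings cs (n * suc t)) (ind (uvOK cu cv)) _)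

  -- Closed forms of χb(B₁*(t+3, n)) and χb(B_{t+3}ⁿ) with k = k' + 1, i.e. d = 2k - 2.
  module ClosedForms (t k' : ℕ) where
    k d q S D : ℕ
    k = suc k'
    d = k' + k'
    q = k + k
    S = sameEnds d (suc t)
    D = diffEnds d (suc t)

    cs : List ℤ
    cs = colors k

    len : length cs ≡ suc (suc d)
    len = trans (colors-length k) (cong suc (+-suc k' k'))

    open Paths cs d len (colors-unique k)
    open Pages cs t

    pageColorings-closed : ∀ n cu cv → cu ∈ cs → cv ∈ cs → pageColorings n cu cv ≡ (if eqb cv cu then S ^ n else D ^ n)
    pageColorings-closed n cu cv cu∈ cv∈ =
      trans (pageColorings-pow n cu cv) (trans (cong (_^ n) (paths-closed (suc t) cu cv cu∈ cv∈)) (pow-if (eqb cv cu)))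
      where
      pow-if : ∀ same → pathCount d (suc t) same ^ n ≡ (if same then S ^ n else D ^ n)
      pow-if true  = refl
      pow-if false = refl

    -- Sum over the spine colors, for a spine forbidding cv = -cu and possibly more.
    spineSum : ∀ n (uvOK : ℤ → ℤ → Bool) (P : ℕ) →
      (∀ cu cv → ind (uvOK cu cv) * (if eqb cv cu then S ^ n else D ^ n) ≡ ind (neq cv (Z.- cu)) * (if eqb cv cu then P else D ^ n)) →
      sumOver cs (λ cu → sumOver cs (λ cv → ind (uvOK cu cv) * pageColorings n cu cv)) ≡ q * (P + d * D ^ n)
    spineSum n uvOK P reduce = begin
      sumOver cs (λ cu → sumOver cs (λ cv → ind (uvOK cu cv) * pageColorings n cu cv))   ≡⟨ sumOver-cong∈ cs inner ⟩
      sumOver cs (λ _ → P + d * D ^ n)                                                    ≡⟨ sumOver-const cs _ ⟩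
      length cs * (P + d * D ^ n)                                                         ≡⟨ cong (_* (P + d * D ^ n)) (colors-length k) ⟩
      q * (P + d * D ^ n)                                                                 ∎
      where
      inner : ∀ cu → cu ∈ cs → sumOver cs (λ cv → ind (uvOK cu cv) * pageColorings n cu cv) ≡ P + d * D ^ n
      inner cu cu∈ = trans (sumOver-cong∈ cs (λ cv cv∈ →
                              trans (cong (ind (uvOK cu cv) *_) (pageColorings-closed n cu cv cu∈ cv∈)) (reduce cu cv)))
                           (sum-excluding-other d len (colors-unique k) (colors-neg k cu∈) cu∈ (colors-≢-neg k cu∈) P (D ^ n))

    χb-B1* : ∀ n → χb (B1* (3 + t) n) k ≡ q * (S ^ n + d * D ^ n)
    χb-B1* n = trans (χb-book t n k (edge 0 1 neg ∷ []) (λ cu cv → neq cv (Z.- cu))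
                                (λ cu cv r → trans (∧-identityʳ _) (negE (cu ∷ cv ∷ r) 0 1)))
                     (spineSum n (λ cu cv → neq cv (Z.- cu)) (S ^ n) (λ _ _ → refl))

    -- Here 0 is the S ^ n contribution of cv = cu, now forbidden.
    χb-Bmn : ∀ n → χb (Bmn (3 + t) n) k ≡ q * (0 + d * D ^ n)
    χb-Bmn n = trans (χb-book t n k (edge 0 1 pos ∷ edge 0 1 neg ∷ []) (λ cu cv → neq cv cu ∧ neq cv (Z.- cu))
                                (λ cu cv r → cong₂ _∧_ (posE (cu ∷ cv ∷ r) 0 1)
                                                       (trans (∧-identityʳ _) (negE (cu ∷ cv ∷ r) 0 1))))
                     (spineSum n (λ cu cv → neq cv cu ∧ neq cv (Z.- cu)) 0 (λ cu cv → forbid-equal (eqb cv cu) (neq cv (Z.- cu))))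
      where
      forbid-equal : ∀ same other → ind (not same ∧ other) * (if same then S ^ n else D ^ n)
                                    ≡ ind other * (if same then 0 else D ^ n)
      forbid-equal true  other = sym (*-zeroʳ (ind other))
      forbid-equal false other = refl

  altSum : ℤ → ℕ → ℤ
  altSum R M = sumℤ (map (λ i → sgnPow i Z.* powℤ R (M ∸ i)) (upTo M))

  sumℤ-neg : ∀ (g h : ℕ → ℤ) L → sumℤ (map (λ i → (Z.- g i) Z.* h i) L) ≡ Z.- sumℤ (map (λ i → g i Z.* h i) L)
  sumℤ-neg g h []      = refl
  sumℤ-neg g h (i ∷ L) = trans (cong₂ Z._+_ (sym (ZP.neg-distribˡ-* (g i) (h i))) (sumℤ-neg g h L))
                               (sym (ZP.neg-distrib-+ (g i Z.* h i) _))

  altSum-suc : ∀ R M → altSum R (suc M) ≡ powℤ R (suc M) Z.+ Z.- altSum R M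
  altSum-suc R M = cong₂ Z._+_ (ZP.*-identityˡ (powℤ R (suc M))) (begin
    sumℤ (map (λ i → sgnPow i Z.* powℤ R (suc M ∸ i)) (applyUpTo suc M))
      ≡⟨ cong (λ L → sumℤ (map (λ i → sgnPow i Z.* powℤ R (suc M ∸ i)) L)) (map-upTo suc M) ⟨
    sumℤ (map (λ i → sgnPow i Z.* powℤ R (suc M ∸ i)) (map suc (upTo M)))
      ≡⟨ cong sumℤ (map-∘ (upTo M)) ⟨
    sumℤ (map (λ i → (Z.- sgnPow i) Z.* powℤ R (M ∸ i)) (upTo M))
      ≡⟨ sumℤ-neg sgnPow (λ i → powℤ R (M ∸ i)) (upTo M) ⟩
    Z.- altSum R M ∎)

  -- Every inner coloring of a path has one of the two end patterns: S_N + (d+1) D_N = (d+1)^(N+1).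
  paths-total : ∀ d N → sameEnds d N + suc d * diffEnds d N ≡ suc d ^ suc N
  paths-total d zero    = refl
  paths-total d (suc N) = trans (regroup d (sameEnds d N) (diffEnds d N)) (cong (suc d *_) (paths-total d N))
    where
    regroup : ∀ d a b → (1 + d) * b + (1 + d) * (a + d * b) ≡ (1 + d) * (a + (1 + d) * b)
    regroup = ℕ-Ring.solve-∀

  powℤ-+ : ∀ r e → powℤ (ι r) e ≡ ι (r ^ e)
  powℤ-+ r zero    = refl
  powℤ-+ r (suc e) = trans (cong (Z._*_ (ι r)) (powℤ-+ r e)) (sym (ZP.pos-* r _))

  altSum-sameEnds : ∀ d M → altSum (ι (suc d)) M ≡ ι (sameEnds d M)
  altSum-sameEnds d zero    = refl
  altSum-sameEnds d (suc M) = begin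
    altSum (ι (suc d)) (suc M)
      ≡⟨ altSum-suc (ι (suc d)) M ⟩
    powℤ (ι (suc d)) (suc M) Z.+ Z.- altSum (ι (suc d)) M
      ≡⟨ cong₂ (λ x y → x Z.+ Z.- y) (powℤ-+ (suc d) (suc M)) (altSum-sameEnds d M) ⟩
    ι (suc d ^ suc M) Z.+ Z.- ι S′
      ≡⟨ cong (λ x → ι x Z.+ Z.- ι S′) (trans (sym (paths-total d M)) (+-comm S′ _)) ⟩
    ι (sameEnds d (suc M) + S′) Z.+ Z.- ι S′
      ≡⟨ cong (Z._+ Z.- ι S′) (ZP.pos-+ (sameEnds d (suc M)) S′) ⟩
    ι (sameEnds d (suc M)) Z.+ ι S′ Z.+ Z.- ι S′
      ≡⟨ cancel (ι (sameEnds d (suc M))) (ι S′) ⟩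
    ι (sameEnds d (suc M)) ∎
    where
    S′ : ℕ
    S′ = sameEnds d M
    cancel : ∀ a b → a Z.+ b Z.+ Z.- b ≡ a
    cancel = ℤ-Ring.solve-∀

  sgnPow-ends : ∀ d N → sgnPow N ≡ ι (diffEnds d N) Z.- ι (sameEnds d N)
  sgnPow-ends d zero    = refl
  sgnPow-ends d (suc N) = begin
    Z.- sgnPow N                                         ≡⟨ cong Z.-_ (sgnPow-ends d N) ⟩
    Z.- (ι D′ Z.- ι S′)                                  ≡⟨ regroup (ι S′) (ι D′) (ι d) ⟩
    (ι S′ Z.+ ι d Z.* ι D′) Z.- (ι D′ Z.+ ι d Z.* ι D′)  ≡⟨ cong₂ Z._-_ (ι-sum S′) (ι-sum D′) ⟨
    ι (diffEnds d (suc N)) Z.- ι (sameEnds d (suc N))    ∎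
    where
    S′ D′ : ℕ
    S′ = sameEnds d N
    D′ = diffEnds d N
    regroup : ∀ P Q d → Z.- (Q Z.- P) ≡ (P Z.+ d Z.* Q) Z.- (Q Z.+ d Z.* Q)
    regroup = ℤ-Ring.solve-∀
    ι-sum : ∀ a → ι (a + d * D′) ≡ ι a Z.+ ι d Z.* ι D′
    ι-sum a = trans (ZP.pos-+ a (d * D′)) (cong (Z._+_ (ι a)) (ZP.pos-* d D′))

  closedForm-recurrence : ∀ (q S D d Sn Dn : ℕ) →
    ι (q * (S * Sn + d * (D * Dn))) ≡ ι S Z.* ι (q * (Sn + d * Dn)) Z.+ (ι D Z.- ι S) Z.* ι (q * (0 + d * Dn))
  closedForm-recurrence q S D d Sn Dn = begin
    ι (q * (S * Sn + d * (D * Dn)))                                      ≡⟨ ι-shape (S * Sn) (D * Dn) ⟩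
    ι q Z.* (ι (S * Sn) Z.+ ι d Z.* ι (D * Dn))                           ≡⟨ cong₂ (λ x y → ι q Z.* (x Z.+ ι d Z.* y)) (ZP.pos-* S Sn) (ZP.pos-* D Dn) ⟩
    ι q Z.* (ι S Z.* ι Sn Z.+ ι d Z.* (ι D Z.* ι Dn))                     ≡⟨ ring (ι q) (ι S) (ι D) (ι d) (ι Sn) (ι Dn) ⟩
    ι S Z.* (ι q Z.* (ι Sn Z.+ ι d Z.* ι Dn)) Z.+ (ι D Z.- ι S) Z.* (ι q Z.* (ι 0 Z.+ ι d Z.* ι Dn))
                                                                         ≡⟨ cong₂ (λ x y → ι S Z.* x Z.+ (ι D Z.- ι S) Z.* y) (ι-shape Sn Dn) (ι-shape 0 Dn) ⟨
    ι S Z.* ι (q * (Sn + d * Dn)) Z.+ (ι D Z.- ι S) Z.* ι (q * (0 + d * Dn)) ∎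
    where
    ι-shape : ∀ a b → ι (q * (a + d * b)) ≡ ι q Z.* (ι a Z.+ ι d Z.* ι b)
    ι-shape a b = trans (ZP.pos-* q _) (cong (Z._*_ (ι q)) (trans (ZP.pos-+ a _) (cong (Z._+_ (ι a)) (ZP.pos-* d b))))
    ring : ∀ q S D d Sn Dn → q Z.* (S Z.* Sn Z.+ d Z.* (D Z.* Dn))
                             ≡ S Z.* (q Z.* (Sn Z.+ d Z.* Dn)) Z.+ (D Z.- S) Z.* (q Z.* (ι 0 Z.+ d Z.* Dn))
    ring = ℤ-Ring.solve-∀

  book-recurrence : ∀ t n' k' →
    ι (χb (B1* (3 + t) (2 + n')) (suc k'))
      ≡ bookCoeff (3 + t) (suc k') Z.* ι (χb (B1* (3 + t) (suc n')) (suc k'))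
        Z.+ sgnPow (suc t) Z.* ι (χb (Bmn (3 + t) (suc n')) (suc k'))
  book-recurrence t n' k' = begin
    ι (χb (B1* (3 + t) (2 + n')) k)                           ≡⟨ cong ι (χb-B1* (2 + n')) ⟩
    ι (q * (S * S ^ suc n' + d * (D * D ^ suc n')))           ≡⟨ closedForm-recurrence q S D d (S ^ suc n') (D ^ suc n') ⟩
    ι S Z.* ι χ₁ Z.+ (ι D Z.- ι S) Z.* ι χ₂                   ≡⟨ cong₂ (λ x y → x Z.* ι χ₁ Z.+ y Z.* ι χ₂) coefficient sign ⟨
    bookCoeff (3 + t) k Z.* ι χ₁ Z.+ sgnPow (suc t) Z.* ι χ₂  ≡⟨ cong₂ (λ x y → bookCoeff (3 + t) k Z.* ι x Z.+ sgnPow (suc t) Z.* ι y)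
                                                                    (χb-B1* (suc n')) (χb-Bmn (suc n')) ⟨
    bookCoeff (3 + t) k Z.* ι (χb (B1* (3 + t) (suc n')) k) Z.+ sgnPow (suc t) Z.* ι (χb (Bmn (3 + t) (suc n')) k) ∎
    where
    open ClosedForms t k'
    two-k-1 : 2 * k ∸ 1 ≡ suc d
    two-k-1 = trans (cong (k' +_) (+-identityʳ k)) (+-suc k' k')
    coefficient : bookCoeff (3 + t) k ≡ ι S
    coefficient = trans (cong (λ R → altSum (ι R) (suc t)) two-k-1) (altSum-sameEnds d (suc t))
    sign : sgnPow (suc t) ≡ ι D Z.- ι S
    sign = sgnPow-ends d (suc t)
    -- the closed forms of χb(B₁*(m, n - 1)) and χb(B_m^(n-1))
    χ₁ χ₂ : ℕ
    χ₁ = q * (S ^ suc n' + d * D ^ suc n')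
    χ₂ = q * (0 + d * D ^ suc n')

open BookChromatic using (book-recurrence)
open import Defs
open import Data.Nat using (ℕ; _≤_; _∸_; suc; s≤s)
open import Data.Integer using (+_; _+_; _*_)
open import Relation.Binary.PropositionalEquality using (_≡_)

theorem7p7 : (m n k : ℕ) → 3 ≤ m → 2 ≤ n → 1 ≤ k →
    + χb (B1* m n) k ≡ bookCoeff m k * + χb (B1* m (n ∸ 1)) k + sgnPow (m ∸ 2) * + χb (Bmn m (n ∸ 1)) k
theorem7p7 (suc (suc (suc t))) (suc (suc n')) (suc k') (s≤s (s≤s (s≤s _))) (s≤s (s≤s _)) (s≤s _) = book-recurrence t n' k'
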